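{- Let $G$ be a simple graph on $[n]$ such that the permutation $w_0:i\mapsto n+1-i$ is a graph automorphism of $G$ (i.e. $\{i,j\}$ is an edge iff $\{n+1-i,n+1-j\}$ is an edge). Then $\mathrm{MTub}(G)$ is self-dual. In particular, $\mathrm{MTub}(P_n)$ and $\mathrm{MTub}(C_n)$ are self-dual.
   Context: A tube of a graph $G$ on $[n]$ is a nonempty vertex set inducing a connected subgraph; tubes $X,Y$ are compatible if $X\subseteq Y$, $Y\subseteq X$, or $X\cup Y$ is not a tube; a maximal tubing is an inclusion-maximal set of pairwise compatible tubes. For a maximal tubing $\mathcal T$ and $x\in[n]$, $\mathcal T_\downarrow(x)$ is the smallest tube of $\mathcal T$ containing $x$, and $\mathrm{top}_{\mathcal T}(T)$ is the unique $x$ with $\mathcal T_\downarrow(x)=T$. $\mathrm{MTub}(G)$ is the poset on maximal tubings generated by covers $\mathcal T\lessdot\mathcal J$ when $\mathcal T\setminus\{T\}=\mathcal J\setminus\{J\}$ with $\mathrm{top}_{\mathcal T}(T)<\mathrm{top}_{\mathcal J}(J)$. $P_n$ is the path with edges $\{i,i+1\}$, $1\le i\le n-1$; $C_n$ ($n\ge3$) is the cycle with edges $\{i,i+1\}$ and $\{n,1\}$. A poset is self-dual if it is isomorphic to its dual. -}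

module Defs where

open import Data.Nat using (ℕ; zero; suc; _∸_; _≥_)
open import Data.Bool using (Bool; true; false)
open import Data.Fin using (Fin; toℕ; opposite; _<_)
open import Data.Fin.Subset using (Subset; _∈_; _∉_; _⊆_; _∪_; Nonempty)
open import Data.Product using (Σ; ∃; _×_; _,_)
open import Data.Sum using (_⊎_)
open import Relation.Nullary using (¬_)
open import Relation.Binary.PropositionalEquality using (_≡_; _≢_)
open import Function.Bundles using (_⇔_)

-- A graph on [n] (vertices Fin n, vertex i ↔ toℕ i + 1), given by its adjacency relation.
Graph : ℕ → Set₁
Graph n = Fin n → Fin n → Set

IsSimple : ∀ {n} → Graph n → Set
IsSimple {n} G = (∀ (i j : Fin n) → G i j → G j i) × (∀ (i : Fin n) → ¬ G i i)

W0Automorphism : ∀ {n} → Graph n → Set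
W0Automorphism {n} G = ∀ (i j : Fin n) → G i j ⇔ G (opposite i) (opposite j)

data PathIn {n} (G : Graph n) (X : Subset n) : Fin n → Fin n → Set where
  here : ∀ {x} → PathIn G X x x
  step : ∀ {x y z} → G x y → y ∈ X → PathIn G X y z → PathIn G X x z

Connected : ∀ {n} → Graph n → Subset n → Set
Connected G X = ∀ x y → x ∈ X → y ∈ X → PathIn G X x y

Tube : ∀ {n} → Graph n → Subset n → Set
Tube G X = Nonempty X × Connected G X

Compatible : ∀ {n} → Graph n → Subset n → Subset n → Set
Compatible G X Y = X ⊆ Y ⊎ Y ⊆ X ⊎ ¬ Tube G (X ∪ Y)

Family : ℕ → Set
Family n = Subset n → Bool

_∈ᶠ_ : ∀ {n} → Subset n → Family n → Set
S ∈ᶠ 𝒯 = 𝒯 S ≡ true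

IsMaximalTubing : ∀ {n} → Graph n → Family n → Set
IsMaximalTubing G 𝒯 =
  (∀ X → X ∈ᶠ 𝒯 → Tube G X)
  × (∀ X Y → X ∈ᶠ 𝒯 → Y ∈ᶠ 𝒯 → Compatible G X Y)
  × (∀ X → Tube G X → (∀ Y → Y ∈ᶠ 𝒯 → Compatible G X Y) → X ∈ᶠ 𝒯)

record MaxTubing {n} (G : Graph n) : Set where
  constructor mkMaxTubing
  field
    tubing : Family n
    isMax  : IsMaximalTubing G tubing
open MaxTubing public

IsDown : ∀ {n} → Family n → Fin n → Subset n → Set
IsDown 𝒯 x T = T ∈ᶠ 𝒯 × x ∈ T × (∀ S → S ∈ᶠ 𝒯 → x ∈ S → T ⊆ S)

IsTop : ∀ {n} → Family n → Subset n → Fin n → Set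
IsTop 𝒯 T x = IsDown 𝒯 x T

Cover : ∀ {n} {G : Graph n} → MaxTubing G → MaxTubing G → Set
Cover {n} 𝒯 𝒥 =
  Σ (Subset n) λ T → Σ (Subset n) λ J → Σ (Fin n) λ x → Σ (Fin n) λ y →
    T ∈ᶠ tubing 𝒯 × J ∈ᶠ tubing 𝒥
    × IsTop (tubing 𝒯) T x × IsTop (tubing 𝒥) J y × x < y
    × (∀ X → (X ∈ᶠ tubing 𝒯 × X ≢ T) ⇔ (X ∈ᶠ tubing 𝒥 × X ≢ J))

data _≤M_ {n} {G : Graph n} : MaxTubing G → MaxTubing G → Set where
  ≤-refl : ∀ {𝒯 𝒥} → (∀ S → tubing 𝒯 S ≡ tubing 𝒥 S) → 𝒯 ≤M 𝒥
  ≤-step : ∀ {𝒯 𝒥 𝒦} → Cover 𝒯 𝒥 → 𝒥 ≤M 𝒦 → 𝒯 ≤M 𝒦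

_≈M_ : ∀ {n} {G : Graph n} → MaxTubing G → MaxTubing G → Set
𝒯 ≈M 𝒥 = ∀ S → tubing 𝒯 S ≡ tubing 𝒥 S

SelfDualMTub : ∀ {n} → Graph n → Set
SelfDualMTub G =
  Σ (MaxTubing G → MaxTubing G) λ φ →
    (∀ a b → a ≈M b → φ a ≈M φ b)
    × (∀ a b → φ a ≈M φ b → a ≈M b)
    × (∀ b → ∃ λ a → φ a ≈M b)
    × (∀ a b → a ≤M b ⇔ φ b ≤M φ a)

P : (n : ℕ) → Graph n
P n i j = toℕ j ≡ suc (toℕ i) ⊎ toℕ i ≡ suc (toℕ j)

-- Cycle C_n: edges {i,i+1} and {n,1}  (used for n ≥ 3).
C : (n : ℕ) → Graph n
C n i j = P n i j ⊎ (toℕ i ≡ 0 × toℕ j ≡ n ∸ 1) ⊎ (toℕ j ≡ 0 × toℕ i ≡ n ∸ 1)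

-- Relabelling the vertices by w₀ sends tubes to tubes and preserves compatibility, so it maps
-- maximal tubings to maximal tubings, with 𝒯↓(w₀ x) the image of 𝒯↓(x). Since w₀ reverses the
-- order of [n], the top of the exchanged tube of a cover becomes the smaller one: the relabelling
-- turns every cover 𝒯 ⋖ 𝒥 into a cover w₀𝒥 ⋖ w₀𝒯. Being an involution, it is therefore an
-- anti-automorphism of MTub(G).
module Submission where

open import Defs
open import Data.Nat using (ℕ; suc; _∸_; _≥_; s≤s)
import Data.Nat as ℕ
open import Data.Nat.Properties using (∸-monoʳ-<; +-∸-assoc; n∸n≡0)
open import Data.Bool using (_∨_)
open import Data.Fin using (Fin; toℕ; opposite; _<_)
open import Data.Fin.Properties using (opposite-prop; opposite-involutive; toℕ<n)
open import Data.Fin.Subset using (Subset; _∈_; _⊆_; _∪_)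
open import Data.Vec using (tabulate; lookup)
open import Data.Vec.Properties
  using (lookup∘tabulate; tabulate∘lookup; tabulate-cong; lookup-zipWith; []=⇒lookup; lookup⇒[]=)
open import Data.Product using (_×_; _,_)
open import Data.Product.Function.NonDependent.Propositional using (_×-⇔_)
open import Data.Sum using (inj₁; inj₂)
open import Function using (id; _∘_)
open import Function.Bundles using (_⇔_; mk⇔; Equivalence)
import Function.Properties.Equivalence as ⇔
open import Relation.Binary.PropositionalEquality
open ≡-Reasoning

opposite-reverses-< : ∀ {n} {x y : Fin n} → x < y → opposite y < opposite x
opposite-reverses-< {x = x} {y} x<y =
  subst₂ ℕ._<_ (sym (opposite-prop y)) (sym (opposite-prop x)) (∸-monoʳ-< (s≤s x<y) (toℕ<n y))

opposite-reverses-successor : ∀ {n} {i j : Fin n} →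
  toℕ j ≡ suc (toℕ i) → toℕ (opposite i) ≡ suc (toℕ (opposite j))
opposite-reverses-successor {n} {i} {j} j≡1+i = begin
  toℕ (opposite i)          ≡⟨ opposite-prop i ⟩
  n ∸ suc (toℕ i)           ≡⟨ cong (n ∸_) j≡1+i ⟨
  n ∸ toℕ j                 ≡⟨ +-∸-assoc 1 (toℕ<n j) ⟩
  suc (n ∸ suc (toℕ j))     ≡⟨ cong suc (opposite-prop j) ⟨
  suc (toℕ (opposite j))    ∎

opposite-first : ∀ {n} {i : Fin n} → toℕ i ≡ 0 → toℕ (opposite i) ≡ n ∸ 1
opposite-first {n} {i} i≡0 = trans (opposite-prop i) (cong (λ k → n ∸ suc k) i≡0)

opposite-last : ∀ {n} {j : Fin n} → toℕ j ≡ n ∸ 1 → toℕ (opposite j) ≡ 0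
opposite-last {suc n} {j} j≡n∸1 = begin
  toℕ (opposite j)        ≡⟨ opposite-prop j ⟩
  suc n ∸ suc (toℕ j)     ≡⟨ cong (n ∸_) j≡n∸1 ⟩
  n ∸ n                   ≡⟨ n∸n≡0 n ⟩
  0                       ∎

preimage : ∀ {m n} → (Fin m → Fin n) → Subset n → Subset m
preimage f S = tabulate (lookup S ∘ f)

module _ {m n : ℕ} {f : Fin m → Fin n} where

  ∈-preimage⁺ : ∀ {x S} → f x ∈ S → x ∈ preimage f S
  ∈-preimage⁺ {x} {S} fx∈S = lookup⇒[]= x (preimage f S) (trans (lookup∘tabulate _ x) ([]=⇒lookup fx∈S))

  ∈-preimage⁻ : ∀ {x S} → x ∈ preimage f S → f x ∈ S
  ∈-preimage⁻ {x} {S} x∈f⁻¹S = lookup⇒[]= (f x) S (trans (sym (lookup∘tabulate _ x)) ([]=⇒lookup x∈f⁻¹S))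

  preimage-mono : ∀ {A B} → A ⊆ B → preimage f A ⊆ preimage f B
  preimage-mono A⊆B = ∈-preimage⁺ ∘ A⊆B ∘ ∈-preimage⁻

  preimage-∪ : ∀ A B → preimage f (A ∪ B) ≡ preimage f A ∪ preimage f B
  preimage-∪ A B = begin
    preimage f (A ∪ B)
      ≡⟨ tabulate-cong (λ i → lookup-zipWith _∨_ (f i) A B) ⟩
    tabulate (λ i → lookup A (f i) ∨ lookup B (f i))
      ≡⟨ tabulate-cong (λ i → cong₂ _∨_ (lookup∘tabulate _ i) (lookup∘tabulate _ i)) ⟨
    tabulate (λ i → lookup f⁻¹A i ∨ lookup f⁻¹B i)
      ≡⟨ tabulate-cong (λ i → lookup-zipWith _∨_ i f⁻¹A f⁻¹B) ⟨
    tabulate (lookup (f⁻¹A ∪ f⁻¹B))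
      ≡⟨ tabulate∘lookup (f⁻¹A ∪ f⁻¹B) ⟩
    f⁻¹A ∪ f⁻¹B
      ∎
    where
      f⁻¹A = preimage f A
      f⁻¹B = preimage f B

preimage-∘ : ∀ {l m n} (f : Fin l → Fin m) (g : Fin m → Fin n) S →
  preimage f (preimage g S) ≡ preimage (g ∘ f) S
preimage-∘ f g S = tabulate-cong (λ i → lookup∘tabulate _ (f i))

preimage-cong : ∀ {m n} {f g : Fin m → Fin n} → (∀ i → f i ≡ g i) → ∀ S → preimage f S ≡ preimage g S
preimage-cong f≗g S = tabulate-cong (cong (lookup S) ∘ f≗g)

preimage-id : ∀ {n} (S : Subset n) → preimage id S ≡ S
preimage-id = tabulate∘lookup

PathIn-map : ∀ {m n} {G : Graph m} {H : Graph n} {X Y} (f : Fin m → Fin n) →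
  (∀ {i j} → G i j → H (f i) (f j)) → (∀ {x} → x ∈ X → f x ∈ Y) →
  ∀ {a b} → PathIn G X a b → PathIn H Y (f a) (f b)
PathIn-map f f-edge f-∈ here              = here
PathIn-map f f-edge f-∈ (step e y∈X path) = step (f-edge e) (f-∈ y∈X) (PathIn-map f f-edge f-∈ path)

∈ᶠ-cong : ∀ {n} {𝒯 𝒯′ : Family n} → (∀ S → 𝒯 S ≡ 𝒯′ S) → ∀ S → S ∈ᶠ 𝒯 ⇔ S ∈ᶠ 𝒯′
∈ᶠ-cong 𝒯≗𝒯′ S = mk⇔ (trans (sym (𝒯≗𝒯′ S))) (trans (𝒯≗𝒯′ S))

IsDown-cong : ∀ {n} {𝒯 𝒯′ : Family n} → (∀ S → 𝒯 S ≡ 𝒯′ S) → ∀ {x T} → IsDown 𝒯 x T → IsDown 𝒯′ x T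
IsDown-cong 𝒯≗𝒯′ (T∈𝒯 , x∈T , T-least) =
  Equivalence.to (∈ᶠ-cong 𝒯≗𝒯′ _) T∈𝒯 , x∈T ,
  λ S S∈𝒯′ → T-least S (Equivalence.from (∈ᶠ-cong 𝒯≗𝒯′ S) S∈𝒯′)

module _ {n : ℕ} {G : Graph n} where

  Cover-respˡ : {a a′ b : MaxTubing G} → a ≈M a′ → Cover a b → Cover a′ b
  Cover-respˡ a≈a′ (T , J , x , y , T∈a , J∈b , topT , topJ , x<y , rest) =
    T , J , x , y , Equivalence.to (∈ᶠ-cong a≈a′ T) T∈a , J∈b ,
    IsDown-cong a≈a′ topT , topJ , x<y ,
    λ X → ⇔.trans (∈ᶠ-cong (sym ∘ a≈a′) X ×-⇔ ⇔.refl) (rest X)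

  ≤M-respˡ : {a a′ b : MaxTubing G} → a ≈M a′ → a ≤M b → a′ ≤M b
  ≤M-respˡ a≈a′ (≤-refl a≈b)                       = ≤-refl λ S → trans (sym (a≈a′ S)) (a≈b S)
  ≤M-respˡ {a} {a′} a≈a′ (≤-step {𝒥 = c} a⋖c c≤b) = ≤-step (Cover-respˡ {a} {a′} {c} a≈a′ a⋖c) c≤b

  ≤M-trans : {a b c : MaxTubing G} → a ≤M b → b ≤M c → a ≤M c
  ≤M-trans (≤-refl a≈b)     b≤c = ≤M-respˡ (sym ∘ a≈b) b≤c
  ≤M-trans (≤-step a⋖d d≤b) b≤c = ≤-step a⋖d (≤M-trans d≤b b≤c)

  ⋖⇒≤M : {a b : MaxTubing G} → Cover a b → a ≤M b
  ⋖⇒≤M {b = b} a⋖b = ≤-step {𝒥 = b} a⋖b (≤-refl λ _ → refl)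

  ≤M-resp-≈M : {a a′ b b′ : MaxTubing G} → a ≈M a′ → b ≈M b′ → a ≤M b → a′ ≤M b′
  ≤M-resp-≈M a≈a′ b≈b′ a≤b = ≤M-respˡ a≈a′ (≤M-trans a≤b (≤-refl b≈b′))

  cover-reversing-involution⇒SelfDualMTub : (φ : MaxTubing G → MaxTubing G) →
    (∀ a b → a ≈M b → φ a ≈M φ b) → (∀ a → φ (φ a) ≈M a) →
    (∀ a b → Cover a b → Cover (φ b) (φ a)) → SelfDualMTub G
  cover-reversing-involution⇒SelfDualMTub φ φ-cong φ-involutive φ-reverses-⋖ =
    φ , φ-cong , φ-injective , (λ b → φ b , φ-involutive b) ,
    λ a b → mk⇔ φ-antitone λ φb≤φa → ≤M-resp-≈M (φ-involutive a) (φ-involutive b) (φ-antitone φb≤φa)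
    where
      φ-injective : ∀ a b → φ a ≈M φ b → a ≈M b
      φ-injective a b φa≈φb S =
        trans (sym (φ-involutive a S)) (trans (φ-cong _ _ φa≈φb S) (φ-involutive b S))

      φ-antitone : ∀ {a b} → a ≤M b → φ b ≤M φ a
      φ-antitone (≤-refl a≈b)                  = ≤-refl (φ-cong _ _ (sym ∘ a≈b))
      φ-antitone {a} (≤-step {𝒥 = c} a⋖c c≤b) = ≤M-trans (φ-antitone c≤b) (⋖⇒≤M (φ-reverses-⋖ a c a⋖c))

module Relabelling {n : ℕ} (G : Graph n) (σ : Fin n → Fin n)
  (σ-involutive : ∀ i → σ (σ i) ≡ i) (σ-edge : ∀ {i j} → G i j → G (σ i) (σ j)) where

  σ⁻¹ : Subset n → Subset n
  σ⁻¹ = preimage σ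

  σ⁻¹-involutive : ∀ S → σ⁻¹ (σ⁻¹ S) ≡ S
  σ⁻¹-involutive S = begin
    σ⁻¹ (σ⁻¹ S)          ≡⟨ preimage-∘ σ σ S ⟩
    preimage (σ ∘ σ) S   ≡⟨ preimage-cong σ-involutive S ⟩
    preimage id S        ≡⟨ preimage-id S ⟩
    S                    ∎

  σ⁻¹-transpose : ∀ {X Y} → σ⁻¹ X ≡ Y → X ≡ σ⁻¹ Y
  σ⁻¹-transpose {X} refl = sym (σ⁻¹-involutive X)

  σ⁻¹-transpose-≢ : ∀ {X Y} → (X ≢ σ⁻¹ Y) ⇔ (σ⁻¹ X ≢ Y)
  σ⁻¹-transpose-≢ = mk⇔ (λ X≢σ⁻¹Y → X≢σ⁻¹Y ∘ σ⁻¹-transpose)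
                        (λ σ⁻¹X≢Y → σ⁻¹X≢Y ∘ sym ∘ σ⁻¹-transpose ∘ sym)

  σ-∈-σ⁻¹ : ∀ {x S} → x ∈ S → σ x ∈ σ⁻¹ S
  σ-∈-σ⁻¹ {x} {S} x∈S = ∈-preimage⁺ (subst (_∈ S) (sym (σ-involutive x)) x∈S)

  Tube-σ⁻¹ : ∀ {X} → Tube G X → Tube G (σ⁻¹ X)
  Tube-σ⁻¹ {X} ((x , x∈X) , connected) = (σ x , σ-∈-σ⁻¹ x∈X) , λ a b a∈ b∈ →
    subst₂ (PathIn G (σ⁻¹ X)) (σ-involutive a) (σ-involutive b)
      (PathIn-map σ σ-edge σ-∈-σ⁻¹ (connected (σ a) (σ b) (∈-preimage⁻ a∈) (∈-preimage⁻ b∈)))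

  Tube-σ⁻¹⁻ : ∀ {X} → Tube G (σ⁻¹ X) → Tube G X
  Tube-σ⁻¹⁻ {X} = subst (Tube G) (σ⁻¹-involutive X) ∘ Tube-σ⁻¹

  Compatible-σ⁻¹ : ∀ {X Y} → Compatible G X Y → Compatible G (σ⁻¹ X) (σ⁻¹ Y)
  Compatible-σ⁻¹ (inj₁ X⊆Y)                  = inj₁ (preimage-mono X⊆Y)
  Compatible-σ⁻¹ (inj₂ (inj₁ Y⊆X))           = inj₂ (inj₁ (preimage-mono Y⊆X))
  Compatible-σ⁻¹ {X} {Y} (inj₂ (inj₂ ¬tube)) =
    inj₂ (inj₂ (¬tube ∘ Tube-σ⁻¹⁻ ∘ subst (Tube G) (sym (preimage-∪ X Y))))

  Compatible-σ⁻¹⁻ : ∀ {X Y} → Compatible G (σ⁻¹ X) (σ⁻¹ Y) → Compatible G X Y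
  Compatible-σ⁻¹⁻ {X} {Y} = subst₂ (Compatible G) (σ⁻¹-involutive X) (σ⁻¹-involutive Y) ∘ Compatible-σ⁻¹

  ∈ᶠ-σ⁻¹ : ∀ (𝒯 : Family n) {S} → S ∈ᶠ 𝒯 → σ⁻¹ S ∈ᶠ (𝒯 ∘ σ⁻¹)
  ∈ᶠ-σ⁻¹ 𝒯 {S} = subst (_∈ᶠ 𝒯) (sym (σ⁻¹-involutive S))

  IsMaximalTubing-σ⁻¹ : ∀ {𝒯} → IsMaximalTubing G 𝒯 → IsMaximalTubing G (𝒯 ∘ σ⁻¹)
  IsMaximalTubing-σ⁻¹ {𝒯} (tubes , compatible , maximal) =
    (λ X X∈ → Tube-σ⁻¹⁻ (tubes (σ⁻¹ X) X∈)) ,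
    (λ X Y X∈ Y∈ → Compatible-σ⁻¹⁻ (compatible _ _ X∈ Y∈)) ,
    λ X tube compatibleWithAll → maximal (σ⁻¹ X) (Tube-σ⁻¹ tube) λ Y Y∈ →
      subst (Compatible G (σ⁻¹ X)) (σ⁻¹-involutive Y)
        (Compatible-σ⁻¹ (compatibleWithAll (σ⁻¹ Y) (∈ᶠ-σ⁻¹ 𝒯 Y∈)))

  relabel : MaxTubing G → MaxTubing G
  relabel (mkMaxTubing 𝒯 isMax) = mkMaxTubing (𝒯 ∘ σ⁻¹) (IsMaximalTubing-σ⁻¹ isMax)

  relabel-cong : ∀ a b → a ≈M b → relabel a ≈M relabel b
  relabel-cong a b a≈b = a≈b ∘ σ⁻¹

  relabel-involutive : ∀ a → relabel (relabel a) ≈M a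
  relabel-involutive a = cong (tubing a) ∘ σ⁻¹-involutive

  IsDown-σ⁻¹ : ∀ {𝒯 : Family n} {x T} → IsDown 𝒯 x T → IsDown (𝒯 ∘ σ⁻¹) (σ x) (σ⁻¹ T)
  IsDown-σ⁻¹ {𝒯} {x} {T} (T∈𝒯 , x∈T , T-least) =
    ∈ᶠ-σ⁻¹ 𝒯 T∈𝒯 , σ-∈-σ⁻¹ x∈T ,
    λ S S∈ σx∈S → subst (σ⁻¹ T ⊆_) (σ⁻¹-involutive S)
      (preimage-mono (T-least (σ⁻¹ S) S∈ (∈-preimage⁺ σx∈S)))

  relabel-reverses-⋖ : (∀ {x y} → x < y → σ y < σ x) → ∀ a b → Cover a b → Cover (relabel b) (relabel a)
  relabel-reverses-⋖ σ-reverses-< a b (T , J , x , y , T∈a , J∈b , topT , topJ , x<y , rest) =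
    σ⁻¹ J , σ⁻¹ T , σ y , σ x , ∈ᶠ-σ⁻¹ (tubing b) J∈b , ∈ᶠ-σ⁻¹ (tubing a) T∈a ,
    IsDown-σ⁻¹ topJ , IsDown-σ⁻¹ topT , σ-reverses-< x<y ,
    λ X → ⇔.trans (⇔.refl ×-⇔ σ⁻¹-transpose-≢)
            (⇔.trans (⇔.sym (rest (σ⁻¹ X))) (⇔.refl ×-⇔ ⇔.sym σ⁻¹-transpose-≢))

W0Automorphism⇒SelfDualMTub : ∀ {n} (G : Graph n) → W0Automorphism G → SelfDualMTub G
W0Automorphism⇒SelfDualMTub G w₀-aut =
  cover-reversing-involution⇒SelfDualMTub relabel relabel-cong relabel-involutive
    (relabel-reverses-⋖ opposite-reverses-<)
  where open Relabelling G opposite opposite-involutive (λ {i} {j} → Equivalence.to (w₀-aut i j))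

opposite-edge⇒W0Automorphism : ∀ {n} (G : Graph n) →
  (∀ {i j} → G i j → G (opposite i) (opposite j)) → W0Automorphism G
opposite-edge⇒W0Automorphism G opposite-edge i j =
  mk⇔ opposite-edge (subst₂ G (opposite-involutive i) (opposite-involutive j) ∘ opposite-edge)

P-opposite-edge : ∀ n {i j} → P n i j → P n (opposite i) (opposite j)
P-opposite-edge n (inj₁ j≡1+i) = inj₂ (opposite-reverses-successor j≡1+i)
P-opposite-edge n (inj₂ i≡1+j) = inj₁ (opposite-reverses-successor i≡1+j)

C-opposite-edge : ∀ n {i j} → C n i j → C n (opposite i) (opposite j)
C-opposite-edge n (inj₁ path-edge)              = inj₁ (P-opposite-edge n path-edge)
C-opposite-edge n (inj₂ (inj₁ (i≡0 , j≡n∸1))) = inj₂ (inj₂ (opposite-last j≡n∸1 , opposite-first i≡0))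
C-opposite-edge n (inj₂ (inj₂ (j≡0 , i≡n∸1))) = inj₂ (inj₁ (opposite-last i≡n∸1 , opposite-first j≡0))

corollary2p5 : ((n : ℕ) (G : Graph n) → IsSimple G → W0Automorphism G → SelfDualMTub G)
    × ((n : ℕ) → SelfDualMTub (P n))
    × ((n : ℕ) → n ≥ 3 → SelfDualMTub (C n))
corollary2p5 =
  (λ n G _ → W0Automorphism⇒SelfDualMTub G) ,
  (λ n → W0Automorphism⇒SelfDualMTub (P n) (opposite-edge⇒W0Automorphism (P n) (P-opposite-edge n))) ,
  (λ n _ → W0Automorphism⇒SelfDualMTub (C n) (opposite-edge⇒W0Automorphism (C n) (C-opposite-edge n)))
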